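{- Let $p$ be an odd prime, written in base $2$ as $p=1+2^{r_1}+2^{r_2}+\cdots+2^{r_l}$ with $1\le r_1<r_2<\cdots<r_l$. Let $\alpha$ be a positive integer. Then $n=2^{\alpha}p$ is a Zumkeller number if and only if $\alpha\geq r_l$.
   Context: A positive integer $n$ is a Zumkeller number if the set of its positive divisors can be partitioned into two disjoint subsets with equal sums. -}

module Defs where

open import Data.Bool using (Bool; true; false; T; not)
open import Data.Nat using (ℕ; suc; _<_; _≤_)
open import Data.Nat.Divisibility using (_∣?_)
open import Data.List using (List; filter; filterᵇ; applyUpTo; map; _++_; [_])
open import Data.Nat.ListAction using (sum)
open import Data.List.Relation.Unary.All using (All)
open import Data.List.Relation.Unary.Linked using (Linked)
open import Data.Product using (∃)
open import Relation.Binary.PropositionalEquality using (_≡_)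

divisors : ℕ → List ℕ
divisors n = filter (_∣? n) (applyUpTo suc n)

-- A partition into two disjoint parts is
-- given by a labelling  f : ℕ → Bool  (part A = divisors labelled true,
-- part B = divisors labelled false).
Zumkeller : ℕ → Set
Zumkeller n = ∃ λ (f : ℕ → Bool) →
  sum (filterᵇ f (divisors n)) ≡ sum (filterᵇ (λ d → not (f d)) (divisors n))

module Submission where

-- Write p = 2q + 1 and M = 1 + 2 + … + 2^α = 2^(α+1) − 1.  The divisors of
-- N = 2^α·p are the powers 2^0, …, 2^α together with their multiples by p, so
-- the side of a partition labelled by f has sum  b + a·p,  where b and a are
-- sums of sets of powers 2^0, …, 2^α; by the binary representation every
-- b, a ≤ M occurs, and the two choices are independent.
--   * If 2^(α+1) ≤ p then b, b' ≤ M < p, so equal sums b + a·p = b' + a'·p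
--     force a = a' by uniqueness of the quotient; but a + a' = M is odd.
--   * If p < 2^(α+1) then b = 2^α − (q+1) and a = 2^α give a side with sum
--     exactly half of σ(N) = M + M·p.
-- Hence 2^α·p is Zumkeller iff p < 2^(α+1).  Finally, the binary expansion
-- p = 1 + 2^r₁ + … + 2^r_l with 1 ≤ r₁ < … < r_l shows that p is odd and
-- 2^r_l < p < 2^(r_l+1), so p < 2^(α+1) iff r_l ≤ α.

open import Defs
open import Data.Bool using (Bool; true; false; not; if_then_else_)
open import Data.Nat
open import Data.Nat.Properties
open import Data.Nat.Divisibility
open import Data.Nat.DivMod using (_/_; m*n/n≡m; m<n⇒m/n≡0; +-distrib-/-∣ʳ)
open import Data.Nat.GCD using (gcd[m,n]∣m; gcd[m,n]∣n)
open import Data.Nat.Coprimality using (gcd≡1⇒coprime; coprime-divisor)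
open import Data.Nat.Primality
open import Data.Nat.ListAction using (sum)
open import Data.Nat.ListAction.Properties using (sum-++; sum-↭)
open import Data.Nat.Tactic.RingSolver using (solve-∀)
open import Data.List using (List; []; _∷_; map; _++_; [_]; filterᵇ; applyUpTo; applyDownFrom)
open import Data.List.Properties using (filter-++)
open import Data.List.Relation.Unary.All as All using (All; []; _∷_)
open import Data.List.Relation.Unary.Linked as Linked using (Linked)
open import Data.List.Relation.Unary.Linked.Properties using (Linked⇒AllPairs)
import Data.List.Relation.Unary.AllPairs as AllPairs
open import Data.List.Relation.Unary.Unique.Propositional using (Unique)
import Data.List.Relation.Unary.Unique.Propositional.Properties as Unique
open import Data.List.Relation.Binary.Disjoint.Propositional using (Disjoint)
open import Data.List.Relation.Binary.Permutation.Propositional using (_↭_)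
open import Data.List.Relation.Binary.Permutation.Propositional.Properties using (filter-↭)
open import Data.List.Relation.Binary.BagAndSetEquality using (∼bag⇒↭)
open import Data.List.Relation.Unary.Any using (there)
open import Data.List.Membership.Propositional using (_∈_)
open import Data.List.Membership.Propositional.Properties
  using (∈-map⁺; ∈-map⁻; ∈-filter⁺; ∈-filter⁻; ∈-applyUpTo⁺; ∈-applyDownFrom⁺; ∈-applyDownFrom⁻; ∈-++⁻; ∈-++⁺ˡ; ∈-++⁺ʳ)
open import Data.List.Membership.Propositional.Properties.WithK using (unique∧set⇒bag)
open import Data.List.Membership.DecPropositional _≟_ using (_∈?_)
open import Data.Product using (∃; _×_; _,_; proj₁; proj₂)
open import Data.Sum using (_⊎_; inj₁; inj₂)
open import Data.Empty using (⊥-elim)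
open import Relation.Nullary using (¬_; does; yes; no)
open import Relation.Nullary.Decidable using (T?; dec-true; dec-false)
open import Relation.Binary.PropositionalEquality hiding ([_])
open import Function using (_∘_)
open import Function.Bundles using (_⇔_; mk⇔)
import Function.Properties.Equivalence as ⇔

open ≡-Reasoning

sumWhere : (ℕ → Bool) → List ℕ → ℕ
sumWhere f xs = sum (filterᵇ f xs)

weight : Bool → ℕ → ℕ
weight b x = if b then x else 0

sumWhere-∷ : ∀ f x xs → sumWhere f (x ∷ xs) ≡ weight (f x) x + sumWhere f xs
sumWhere-∷ f x xs with f x
... | true  = refl
... | false = refl

sumWhere-cong : ∀ {f g} xs → All (λ x → f x ≡ g x) xs → sumWhere f xs ≡ sumWhere g xs
sumWhere-cong         []       []       = refl
sumWhere-cong {f} {g} (x ∷ xs) (e ∷ es) = begin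
  sumWhere f (x ∷ xs)              ≡⟨ sumWhere-∷ f x xs ⟩
  weight (f x) x + sumWhere f xs   ≡⟨ cong₂ _+_ (cong (λ b → weight b x) e) (sumWhere-cong xs es) ⟩
  weight (g x) x + sumWhere g xs   ≡⟨ sumWhere-∷ g x xs ⟨
  sumWhere g (x ∷ xs)              ∎

sumWhere-all : ∀ xs → sumWhere (λ _ → true) xs ≡ sum xs
sumWhere-all []       = refl
sumWhere-all (x ∷ xs) = cong (x +_) (sumWhere-all xs)

sumWhere-complement : ∀ f xs → sumWhere f xs + sumWhere (not ∘ f) xs ≡ sum xs
sumWhere-complement f []       = refl
sumWhere-complement f (x ∷ xs) = begin
  sumWhere f (x ∷ xs) + sumWhere (not ∘ f) (x ∷ xs)
    ≡⟨ cong₂ _+_ (sumWhere-∷ f x xs) (sumWhere-∷ (not ∘ f) x xs) ⟩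
  (weight (f x) x + sumWhere f xs) + (weight (not (f x)) x + sumWhere (not ∘ f) xs)
    ≡⟨ interchange (weight (f x) x) _ _ _ ⟩
  (weight (f x) x + weight (not (f x)) x) + (sumWhere f xs + sumWhere (not ∘ f) xs)
    ≡⟨ cong₂ _+_ (split (f x)) (sumWhere-complement f xs) ⟩
  x + sum xs ∎
  where
  interchange : ∀ a b c d → (a + b) + (c + d) ≡ (a + c) + (b + d)
  interchange = solve-∀
  split : ∀ b → weight b x + weight (not b) x ≡ x
  split true  = +-identityʳ x
  split false = refl

balanced : ∀ f xs → sumWhere f xs + sumWhere f xs ≡ sum xs →
           sumWhere f xs ≡ sumWhere (not ∘ f) xs
balanced f xs half = +-cancelˡ-≡ (sumWhere f xs) _ _
  (trans half (sym (sumWhere-complement f xs)))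

sumWhere-++ : ∀ f xs ys → sumWhere f (xs ++ ys) ≡ sumWhere f xs + sumWhere f ys
sumWhere-++ f xs ys rewrite filter-++ (T? ∘ f) xs ys = sum-++ (filterᵇ f xs) (filterᵇ f ys)

sumWhere-↭ : ∀ f {xs ys} → xs ↭ ys → sumWhere f xs ≡ sumWhere f ys
sumWhere-↭ f xs↭ys = sum-↭ (filter-↭ (T? ∘ f) xs↭ys)

sumWhere-scale : ∀ f c xs → sumWhere f (map (_* c) xs) ≡ sumWhere (f ∘ (_* c)) xs * c
sumWhere-scale f c []       = refl
sumWhere-scale f c (x ∷ xs) = begin
  sumWhere f (map (_* c) (x ∷ xs))
    ≡⟨ sumWhere-∷ f (x * c) (map (_* c) xs) ⟩
  weight (f (x * c)) (x * c) + sumWhere f (map (_* c) xs)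
    ≡⟨ cong₂ _+_ (weight-scale (f (x * c))) (sumWhere-scale f c xs) ⟩
  weight (f (x * c)) x * c + sumWhere (f ∘ (_* c)) xs * c
    ≡⟨ *-distribʳ-+ c (weight (f (x * c)) x) _ ⟨
  (weight (f (x * c)) x + sumWhere (f ∘ (_* c)) xs) * c
    ≡⟨ cong (_* c) (sumWhere-∷ (f ∘ (_* c)) x xs) ⟨
  sumWhere (f ∘ (_* c)) (x ∷ xs) * c ∎
  where
  weight-scale : ∀ b → weight b (x * c) ≡ weight b x * c
  weight-scale true  = refl
  weight-scale false = refl

relabel : ℕ → Bool → (ℕ → Bool) → ℕ → Bool
relabel x b f d = if does (d ≟ x) then b else f d

sumWhere-relabel : ∀ b f x xs → All (_≢ x) xs →
                   sumWhere (relabel x b f) (x ∷ xs) ≡ weight b x + sumWhere f xs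
sumWhere-relabel b f x xs fresh = begin
  sumWhere (relabel x b f) (x ∷ xs)
    ≡⟨ sumWhere-∷ (relabel x b f) x xs ⟩
  weight (relabel x b f x) x + sumWhere (relabel x b f) xs
    ≡⟨ cong₂ _+_ (cong (λ c → weight (if c then b else f x) x) (dec-true (x ≟ x) refl))
                 (sumWhere-cong xs (All.map unchanged fresh)) ⟩
  weight b x + sumWhere f xs ∎
  where
  unchanged : ∀ {d} → d ≢ x → relabel x b f d ≡ f d
  unchanged {d} d≢x = cong (λ c → if c then b else f d) (dec-false (d ≟ x) d≢x)

powers : ℕ → List ℕ
powers a = applyDownFrom (2 ^_) (suc a)

1<2 : 1 < 2
1<2 = n<1+n 1

powers-< : ∀ a → All (_< 2 ^ suc a) (powers a)
powers-< a = All.tabulate below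
  where
  below : ∀ {x} → x ∈ powers a → x < 2 ^ suc a
  below x∈ with i , i<1+a , refl ← ∈-applyDownFrom⁻ (2 ^_) x∈ = ^-monoʳ-< 2 1<2 i<1+a

powers-unique : ∀ a → Unique (powers a)
powers-unique a = Unique.applyDownFrom⁺₁ (2 ^_) (suc a)
  (λ j<i _ e → <⇒≢ (^-monoʳ-< 2 1<2 j<i) (sym e))

sum-powers : ∀ a → suc (sum (powers a)) ≡ 2 ^ suc a
sum-powers zero    = refl
sum-powers (suc a) = begin
  suc (2 ^ suc a + sum (powers a))  ≡⟨ +-suc (2 ^ suc a) _ ⟨
  2 ^ suc a + suc (sum (powers a))  ≡⟨ cong (2 ^ suc a +_) (sum-powers a) ⟩
  2 ^ suc a + 2 ^ suc a             ≡⟨ cong (2 ^ suc a +_) (+-identityʳ (2 ^ suc a)) ⟨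
  2 ^ suc (suc a)                   ∎

-- Binary representation: every k ≤ 2^(a+1) − 1 is the sum of a set of the
-- powers 2^0, …, 2^a (greedily: take 2^a iff it fits).
subsetSum : ∀ a k → k ≤ sum (powers a) → ∃ λ f → sumWhere f (powers a) ≡ k
subsetSum zero    zero          _        = (λ _ → false) , refl
subsetSum zero    (suc zero)    _        = (λ _ → true) , refl
subsetSum zero    (suc (suc k)) (s≤s ())
subsetSum (suc a) k             k≤ with 2 ^ suc a ≤? k
... | yes top≤k =
  let f , sum≡ = subsetSum a (k ∸ 2 ^ suc a) (m≤n+o⇒m∸n≤o k (2 ^ suc a) k≤)
  in relabel (2 ^ suc a) true f , (begin
    sumWhere (relabel (2 ^ suc a) true f) (powers (suc a))
      ≡⟨ sumWhere-relabel true f (2 ^ suc a) (powers a) (All.map <⇒≢ (powers-< a)) ⟩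
    2 ^ suc a + sumWhere f (powers a)
      ≡⟨ cong (2 ^ suc a +_) sum≡ ⟩
    2 ^ suc a + (k ∸ 2 ^ suc a)
      ≡⟨ m+[n∸m]≡n top≤k ⟩
    k ∎)
... | no top≰k =
  let f , sum≡ = subsetSum a k (≤-pred (subst (k <_) (sym (sum-powers a)) (≰⇒> top≰k)))
  in relabel (2 ^ suc a) false f
   , trans (sumWhere-relabel false f (2 ^ suc a) (powers a) (All.map <⇒≢ (powers-< a))) sum≡

prime-divisor-split : ∀ {p x m} → Prime p → x ∣ p * m →
                      x ∣ m ⊎ ∃ λ z → x ≡ z * p × z ∣ m
prime-divisor-split {p} {x} {m} p-prime x∣pm with prime⇒irreducible p-prime (gcd[m,n]∣n x p)
... | inj₁ gcd≡1 = inj₁ (coprime-divisor (gcd≡1⇒coprime gcd≡1) x∣pm)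
... | inj₂ gcd≡p with divides z refl ← subst (_∣ x) gcd≡p (gcd[m,n]∣m x p) =
  inj₂ (z , refl , *-cancelʳ-∣ p {{prime⇒nonZero p-prime}} (subst (z * p ∣_) (*-comm p m) x∣pm))

2^-mono-∣ : ∀ {i a} → i ≤ a → 2 ^ i ∣ 2 ^ a
2^-mono-∣ {i} {a} i≤a = divides (2 ^ (a ∸ i)) (begin
  2 ^ a               ≡⟨ cong (2 ^_) (m∸n+n≡m i≤a) ⟨
  2 ^ (a ∸ i + i)     ≡⟨ ^-distribˡ-+-* 2 (a ∸ i) i ⟩
  2 ^ (a ∸ i) * 2 ^ i ∎)

∈powers⇒∣ : ∀ {x} a → x ∈ powers a → x ∣ 2 ^ a
∈powers⇒∣ a x∈ with i , i<1+a , refl ← ∈-applyDownFrom⁻ (2 ^_) x∈ = 2^-mono-∣ (≤-pred i<1+a)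

∣⇒∈powers : ∀ {x} a → x ∣ 2 ^ a → x ∈ powers a
∣⇒∈powers zero    x∣1 rewrite ∣1⇒≡1 x∣1 = ∈-applyDownFrom⁺ (2 ^_) (n<1+n 0)
∣⇒∈powers (suc a) x∣ with prime-divisor-split prime[2] x∣
... | inj₁ x∣2^a = there (∣⇒∈powers a x∣2^a)
... | inj₂ (z , refl , z∣2^a) with i , i<1+a , refl ← ∈-applyDownFrom⁻ (2 ^_) (∣⇒∈powers a z∣2^a) =
  subst (_∈ powers (suc a)) (*-comm 2 (2 ^ i)) (∈-applyDownFrom⁺ (2 ^_) (s≤s i<1+a))

odd-not-power : ∀ {P q} → P ≡ suc (2 * q) → P ≢ 1 → ∀ m → P ≢ 2 ^ m
odd-not-power         odd P≢1 zero    P≡1   = P≢1 P≡1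
odd-not-power {q = q} odd P≢1 (suc m) P≡2^m = even≢odd (2 ^ m) q (trans (sym P≡2^m) odd)

∈divisors⇔∣ : ∀ n .{{_ : NonZero n}} {x} → x ∈ divisors n ⇔ x ∣ n
∈divisors⇔∣ n = mk⇔ (λ x∈ → proj₂ (∈-filter⁻ (_∣? n) {xs = applyUpTo suc n} x∈))
                    (λ x∣n → ∈-filter⁺ (_∣? n) (in-range _ x∣n) x∣n)
  where
  in-range : ∀ x → x ∣ n → x ∈ applyUpTo suc n
  in-range zero    0∣n = ⊥-elim (≢-nonZero⁻¹ n (0∣⇒≡0 0∣n))
  in-range (suc i) x∣n = ∈-applyUpTo⁺ suc (∣⇒≤ x∣n)

divisors-unique : ∀ n → Unique (divisors n)
divisors-unique n = Unique.filter⁺ (_∣? n)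
  (Unique.applyUpTo⁺₁ suc n (λ i<j _ e → <⇒≢ i<j (suc-injective e)))

quotient-unique : ∀ {P b b' a a'} .{{_ : NonZero P}} → b < P → b' < P →
                  b + a * P ≡ b' + a' * P → a ≡ a'
quotient-unique {P} {b} {b'} {a} {a'} b<P b'<P e = begin
  a                   ≡⟨ quotient-of b<P ⟨
  (b + a * P) / P     ≡⟨ cong (_/ P) e ⟩
  (b' + a' * P) / P   ≡⟨ quotient-of b'<P ⟩
  a'                  ∎
  where
  quotient-of : ∀ {r c} → r < P → (r + c * P) / P ≡ c
  quotient-of {r} {c} r<P = begin
    (r + c * P) / P      ≡⟨ +-distrib-/-∣ʳ r (n∣m*n c) ⟩
    r / P + c * P / P    ≡⟨ cong₂ _+_ (m<n⇒m/n≡0 r<P) (m*n/n≡m c P) ⟩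
    c                    ∎

-- The balancing identity: if 2^α = b + q + 1 and P = 2q + 1 then the side
-- b + 2^α·P is half of σ(2^α·P) = M + M·P, where M = 2^(α+1) − 1.
half-of-σ : ∀ {b q M P} → P ≡ suc (2 * q) → suc M ≡ 2 * (b + suc q) →
            (b + (b + suc q) * P) + (b + (b + suc q) * P) ≡ M + M * P
half-of-σ {b} {q} {M} refl sucM≡ =
  subst (λ m → _ ≡ m + m * suc (2 * q)) (suc-injective (sym (trans sucM≡ (double b q)))) (identity b q)
  where
  double : ∀ b q → 2 * (b + suc q) ≡ suc (2 * (b + q) + 1)
  double = solve-∀
  identity : ∀ b q → let T = b + suc q; P = suc (2 * q); M = 2 * (b + q) + 1 in
             (b + T * P) + (b + T * P) ≡ M + M * P
  identity = solve-∀

module TwoPowerTimesOddPrime {P q : ℕ} (P-prime : Prime P) (odd : P ≡ suc (2 * q)) (α : ℕ) where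

  N : ℕ
  N = 2 ^ α * P

  instance
    P≢0 : NonZero P
    P≢0 = prime⇒nonZero P-prime

    N≢0 : NonZero N
    N≢0 = m*n≢0 (2 ^ α) P {{m^n≢0 2 α}}

  M : ℕ
  M = sum (powers α)

  -- The numbers 2^i·P are never powers of two, since P is odd and P ≠ 1.
  multiple-not-power : ∀ i j → 2 ^ i * P ≢ 2 ^ j
  multiple-not-power i j e
    with m , _ , P≡2^m ← ∈-applyDownFrom⁻ (2 ^_) (∣⇒∈powers j (subst (P ∣_) e (n∣m*n (2 ^ i))))
    = odd-not-power {q = q} odd (nonTrivial⇒≢1 {{prime⇒nonTrivial P-prime}}) m P≡2^m

  multiple∉powers : ∀ {d} a b → d ∈ powers a → ¬ (d * P ∈ powers b)
  multiple∉powers a b d∈ dP∈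
    with i , _ , refl ← ∈-applyDownFrom⁻ (2 ^_) d∈
       | j , _ , e    ← ∈-applyDownFrom⁻ (2 ^_) dP∈ = multiple-not-power i j e

  divisorList : List ℕ
  divisorList = powers α ++ map (_* P) (powers α)

  divisorList-unique : Unique divisorList
  divisorList-unique = Unique.++⁺ (powers-unique α)
    (Unique.map⁺ (λ {x} {y} → *-cancelʳ-≡ x y P) (powers-unique α)) disjoint
    where
    disjoint : Disjoint (powers α) (map (_* P) (powers α))
    disjoint (d∈ , e∈) with y , y∈ , refl ← ∈-map⁻ (_* P) {xs = powers α} e∈ = multiple∉powers α α y∈ d∈

  ∣⇒∈divisorList : ∀ {x} → x ∣ N → x ∈ divisorList
  ∣⇒∈divisorList {x} x∣ with prime-divisor-split P-prime (subst (x ∣_) (*-comm (2 ^ α) P) x∣)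
  ... | inj₁ x∣2^α              = ∈-++⁺ˡ (∣⇒∈powers α x∣2^α)
  ... | inj₂ (z , refl , z∣2^α) = ∈-++⁺ʳ (powers α) (∈-map⁺ (_* P) (∣⇒∈powers α z∣2^α))

  ∈divisorList⇒∣ : ∀ {x} → x ∈ divisorList → x ∣ N
  ∈divisorList⇒∣ x∈ with ∈-++⁻ (powers α) x∈
  ... | inj₁ x∈powers = ∣m⇒∣m*n P (∈powers⇒∣ α x∈powers)
  ... | inj₂ x∈multiples with y , y∈ , refl ← ∈-map⁻ (_* P) {xs = powers α} x∈multiples =
    *-monoˡ-∣ P (∈powers⇒∣ α y∈)

  divisors-↭ : divisors N ↭ divisorList
  divisors-↭ = ∼bag⇒↭ (unique∧set⇒bag (divisors-unique N) divisorList-unique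
    (⇔.trans (∈divisors⇔∣ N) (mk⇔ ∣⇒∈divisorList ∈divisorList⇒∣)))

  sumWhere-divisors : ∀ f → sumWhere f (divisors N)
                            ≡ sumWhere f (powers α) + sumWhere (f ∘ (_* P)) (powers α) * P
  sumWhere-divisors f = begin
    sumWhere f (divisors N)
      ≡⟨ sumWhere-↭ f divisors-↭ ⟩
    sumWhere f divisorList
      ≡⟨ sumWhere-++ f (powers α) _ ⟩
    sumWhere f (powers α) + sumWhere f (map (_* P) (powers α))
      ≡⟨ cong (sumWhere f (powers α) +_) (sumWhere-scale f P (powers α)) ⟩
    sumWhere f (powers α) + sumWhere (f ∘ (_* P)) (powers α) * P ∎

  σ : sum (divisors N) ≡ M + M * P
  σ = begin
    sum (divisors N)                    ≡⟨ sumWhere-all (divisors N) ⟨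
    sumWhere (λ _ → true) (divisors N)  ≡⟨ sumWhere-divisors (λ _ → true) ⟩
    sumWhere (λ _ → true) (powers α) + sumWhere (λ _ → true) (powers α) * P
      ≡⟨ cong (λ s → s + s * P) (sumWhere-all (powers α)) ⟩
    M + M * P                                     ∎

  -- Conversely, the labels of the powers of two and of their multiples by P
  -- can be prescribed independently.
  combine : (ℕ → Bool) → (ℕ → Bool) → ℕ → Bool
  combine f g d = if does (d ∈? powers α) then f d else g (d / P)

  sumWhere-combine : ∀ f g → sumWhere (combine f g) (divisors N)
                             ≡ sumWhere f (powers α) + sumWhere g (powers α) * P
  sumWhere-combine f g = trans (sumWhere-divisors (combine f g))
    (cong₂ (λ b a → b + a * P) (sumWhere-cong (powers α) (All.tabulate on-powers))
                               (sumWhere-cong (powers α) (All.tabulate on-multiples)))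
    where
    on-powers : ∀ {d} → d ∈ powers α → combine f g d ≡ f d
    on-powers {d} d∈ = cong (λ c → if c then f d else g (d / P)) (dec-true (d ∈? powers α) d∈)
    on-multiples : ∀ {d} → d ∈ powers α → combine f g (d * P) ≡ g d
    on-multiples {d} d∈ = begin
      combine f g (d * P)  ≡⟨ cong (λ c → if c then f (d * P) else g (d * P / P))
                                   (dec-false (d * P ∈? powers α) (multiple∉powers α α d∈)) ⟩
      g (d * P / P)        ≡⟨ cong g (m*n/n≡m d P) ⟩
      g d                  ∎

  -- If 2^(α+1) ≤ P, the parts b, b' < P of the two sides are remainders mod P,
  -- so balanced sides b + a·P = b' + a'·P force a = a'; but a + a' = M is odd.
  not-zumkeller : 2 ^ suc α ≤ P → ¬ Zumkeller N
  not-zumkeller 2^α+1≤P (f , balanced-f) = even≢odd (2 ^ α) a (begin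
    2 * 2 ^ α       ≡⟨ sum-powers α ⟨
    suc M           ≡⟨ cong suc a+a'≡M ⟨
    suc (a + a')    ≡⟨ cong (λ c → suc (a + c)) a≡a' ⟨
    suc (a + a)     ≡⟨ cong (λ c → suc (a + c)) (+-identityʳ a) ⟨
    suc (2 * a)     ∎)
    where
    b b' a a' : ℕ
    b  = sumWhere f (powers α)
    b' = sumWhere (not ∘ f) (powers α)
    a  = sumWhere (f ∘ (_* P)) (powers α)
    a' = sumWhere (not ∘ f ∘ (_* P)) (powers α)
    a+a'≡M : a + a' ≡ M
    a+a'≡M = sumWhere-complement (f ∘ (_* P)) (powers α)
    M<P : M < P
    M<P = subst (_≤ P) (sym (sum-powers α)) 2^α+1≤P
    b+b'≡M : b + b' ≡ M
    b+b'≡M = sumWhere-complement f (powers α)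
    sides : b + a * P ≡ b' + a' * P
    sides = trans (sym (sumWhere-divisors f)) (trans balanced-f (sumWhere-divisors (not ∘ f)))
    a≡a' : a ≡ a'
    a≡a' = quotient-unique (≤-<-trans (subst (b ≤_) b+b'≡M (m≤m+n b b')) M<P)
                           (≤-<-trans (subst (b' ≤_) b+b'≡M (m≤n+m b' b)) M<P) sides

  -- If P < 2^(α+1) then q + 1 ≤ 2^α; the powers of two summing to
  -- b = 2^α − (q + 1), together with the single divisor 2^α·P, form a side
  -- whose sum b + 2^α·P is exactly half of σ(2^α·P).
  zumkeller : P < 2 ^ suc α → Zumkeller N
  zumkeller P<2^α+1 = side-of , balanced side-of (divisors N) half
    where
    q<2^α : q < 2 ^ α
    q<2^α = *-cancelˡ-< 2 q (2 ^ α) (≤-trans (n≤1+n _) (subst (_< 2 ^ suc α) odd P<2^α+1))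
    b : ℕ
    b = 2 ^ α ∸ suc q
    b+q+1≡2^α : b + suc q ≡ 2 ^ α
    b+q+1≡2^α = m∸n+n≡m q<2^α
    2^α≤M : 2 ^ α ≤ M
    2^α≤M = ≤-pred (subst (2 ^ α <_) (sym (sum-powers α)) (^-monoʳ-< 2 1<2 (n<1+n α)))
    low : ∃ λ f → sumWhere f (powers α) ≡ b
    low = subsetSum α b (≤-trans (m∸n≤m (2 ^ α) (suc q)) 2^α≤M)
    high : ∃ λ g → sumWhere g (powers α) ≡ 2 ^ α
    high = subsetSum α (2 ^ α) 2^α≤M
    side-of : ℕ → Bool
    side-of = combine (proj₁ low) (proj₁ high)
    side : sumWhere side-of (divisors N) ≡ b + (b + suc q) * P
    side = trans (sumWhere-combine (proj₁ low) (proj₁ high))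
      (cong₂ (λ x y → x + y * P) (proj₂ low) (trans (proj₂ high) (sym b+q+1≡2^α)))
    half : sumWhere side-of (divisors N) + sumWhere side-of (divisors N)
             ≡ sum (divisors N)
    half = begin
      sumWhere side-of (divisors N) + sumWhere side-of (divisors N)
        ≡⟨ cong₂ _+_ side side ⟩
      (b + (b + suc q) * P) + (b + (b + suc q) * P)
        ≡⟨ half-of-σ {b} {q} {M} odd (trans (sum-powers α) (cong (2 *_) (sym b+q+1≡2^α))) ⟩
      M + M * P
        ≡⟨ σ ⟨
      sum (divisors N) ∎

  zumkeller⇔ : Zumkeller N ⇔ P < 2 ^ suc α
  zumkeller⇔ = mk⇔ bounded zumkeller
    where
    bounded : Zumkeller N → P < 2 ^ suc α
    bounded z with P <? 2 ^ suc α
    ... | yes P<2^α+1 = P<2^α+1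
    ... | no  P≮2^α+1 = ⊥-elim (not-zumkeller (≮⇒≥ P≮2^α+1) z)

expansion : List ℕ → ℕ
expansion rs = sum (map (2 ^_) rs)

expansion-even : ∀ rs → All (1 ≤_) rs → ∃ λ q → expansion rs ≡ 2 * q
expansion-even []           []           = 0 , refl
expansion-even (suc r ∷ rs) (_ ∷ 1≤rs) with q , rs≡2q ← expansion-even rs 1≤rs =
  2 ^ r + q , (begin
    2 * 2 ^ r + expansion rs  ≡⟨ cong (2 * 2 ^ r +_) rs≡2q ⟩
    2 * 2 ^ r + 2 * q         ≡⟨ *-distribˡ-+ 2 (2 ^ r) q ⟨
    2 * (2 ^ r + q)           ∎)

top≤expansion : ∀ rs rl → 2 ^ rl ≤ expansion (rs ++ [ rl ])
top≤expansion []       rl = m≤m+n (2 ^ rl) 0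
top≤expansion (r ∷ rs) rl = ≤-trans (top≤expansion rs rl) (m≤n+m _ (2 ^ r))

-- For increasing exponents, all at least lo, adding 2^lo to the expansion
-- stays below 2^(r_l + 1) (the carries propagate up to the top term).
expansion+2^lo≤ : ∀ rs rl lo → All (lo ≤_) (rs ++ [ rl ]) → Linked _<_ (rs ++ [ rl ]) →
                  expansion (rs ++ [ rl ]) + 2 ^ lo ≤ 2 ^ suc rl
expansion+2^lo≤ [] rl lo (lo≤rl ∷ []) _ =
  ≤-trans (+-monoʳ-≤ (2 ^ rl + 0) (^-monoʳ-≤ 2 lo≤rl)) (≤-reflexive (+-comm (2 ^ rl + 0) (2 ^ rl)))
expansion+2^lo≤ (r ∷ rs) rl lo (lo≤r ∷ _) increasing =
  ≤-trans (+-monoʳ-≤ (2 ^ r + rest) (^-monoʳ-≤ 2 lo≤r))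
          (subst (_≤ 2 ^ suc rl) (sym (regroup (2 ^ r) rest)) rest+2^r+1≤)
  where
  rest : ℕ
  rest = expansion (rs ++ [ rl ])
  rest+2^r+1≤ : rest + 2 ^ suc r ≤ 2 ^ suc rl
  rest+2^r+1≤ = expansion+2^lo≤ rs rl (suc r)
    (AllPairs.head (Linked⇒AllPairs <-trans increasing)) (Linked.tail increasing)
  regroup : ∀ x s → (x + s) + x ≡ s + 2 * x
  regroup = solve-∀

-- p = 1 + 2^r₁ + … + 2^r_l lies strictly between 2^r_l and 2^(r_l + 1), hence
-- p < 2^(α+1) iff r_l ≤ α.
expansion-below⇔ : ∀ {p} rs rl → All (1 ≤_) (rs ++ [ rl ]) → Linked _<_ (rs ++ [ rl ]) →
                   p ≡ 1 + expansion (rs ++ [ rl ]) → ∀ α → p < 2 ^ suc α ⇔ rl ≤ α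
expansion-below⇔ {p} rs rl 1≤rs increasing refl α = mk⇔ to from
  where
  to : p < 2 ^ suc α → rl ≤ α
  to p<2^α+1 = ≮⇒≥ λ α<rl → <⇒≱ p<2^α+1
    (≤-trans (^-monoʳ-≤ 2 α<rl) (≤-trans (top≤expansion rs rl) (n≤1+n _)))
  from : rl ≤ α → p < 2 ^ suc α
  from rl≤α = subst (_≤ 2 ^ suc α) (+-comm (expansion (rs ++ [ rl ])) 2)
    (≤-trans (expansion+2^lo≤ rs rl 1 1≤rs increasing) (^-monoʳ-≤ 2 (s≤s rl≤α)))

-- The theorem: the expansion makes p odd, so 2^α·p is Zumkeller iff
-- p < 2^(α+1), i.e. iff r_l ≤ α.
mainTheorem2 : (p : ℕ) → Prime p → p ≢ 2 →
    (rs : List ℕ) → (rl : ℕ) →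
    All (1 ≤_) (rs ++ [ rl ]) → Linked _<_ (rs ++ [ rl ]) →
    p ≡ 1 + sum (map (2 ^_) (rs ++ [ rl ])) →
    (α : ℕ) → 1 ≤ α →
    Zumkeller (2 ^ α * p) ⇔ (rl ≤ α)
mainTheorem2 p p-prime _ rs rl 1≤rs increasing p≡ α _
  with q , expansion≡2q ← expansion-even (rs ++ [ rl ]) 1≤rs =
  ⇔.trans (TwoPowerTimesOddPrime.zumkeller⇔ {q = q} p-prime (trans p≡ (cong suc expansion≡2q)) α)
          (expansion-below⇔ rs rl 1≤rs increasing p≡ α)
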